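{- Let $0\le k_1\le k_2\le\cdots\le k_s\le N$ be fixed integers, let $1\le r\le s$ and $m\ge k_r+1$. Then $$W(m,k_1,\ldots,k_r)=T_{r-1}(m-1,k_1,\ldots,k_r)+(m-1)\cdot W(m-1,k_1,\ldots,k_r).$$
   Context: For integers $0\le k_1\le\cdots\le k_r$, the $(k_1,\ldots,k_r)$-strategy applied to a permutation $\pi$ of length $m$ (entries revealed from the left) proceeds as follows: for the $i$-th selection ($1\le i\le r$) it waits until the $(i-1)$-th selection has been made (if $i\ge2$), rejects the first $k_i$ positions, and selects the next position that is a left-to-right maximum of $\pi$ (a position whose value exceeds all values to its left); at most $r$ selections are made. $T_q(m,k_1,\ldots,k_r)$ denotes the number of $\pi\in S_m$ on which this strategy makes at most $q$ selections, and $W(m,k_1,\ldots,k_r)$ denotes the number of $\pi\in S_m$ for which the position holding the value $m$ is selected by this strategy. -}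

module Defs where

open import Data.Nat using (ℕ; zero; suc; _+_; _∸_; _⊔_; _<ᵇ_; _≡ᵇ_; _≤?_)
open import Data.Bool using (Bool; true; false; if_then_else_; _∨_)
open import Data.List using (List; []; _∷_; map; concatMap; length; filter)
open import Data.Maybe using (Maybe; just; nothing)

-- Permutations of length m are represented as lists of their values
-- π(1),…,π(m), a rearrangement of 1,…,m.

insertions : ℕ → List ℕ → List (List ℕ)
insertions x []       = (x ∷ []) ∷ []
insertions x (y ∷ ys) = (x ∷ y ∷ ys) ∷ map (y ∷_) (insertions x ys)

perms : ℕ → List (List ℕ)
perms zero    = [] ∷ []
perms (suc n) = concatMap (insertions (suc n)) (perms n)

-- positions (1-based, increasing) of the left-to-right maxima of π;
-- arguments: current position, maximum of the values seen so far
ltrGo : ℕ → ℕ → List ℕ → List ℕ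
ltrGo p mx []       = []
ltrGo p mx (x ∷ xs) =
  if mx <ᵇ x then p ∷ ltrGo (suc p) x xs else ltrGo (suc p) mx xs

ltrMaxPositions : List ℕ → List ℕ
ltrMaxPositions π = ltrGo 1 0 π

firstAbove : ℕ → List ℕ → Maybe ℕ
firstAbove b []       = nothing
firstAbove b (p ∷ ps) = if b <ᵇ p then just p else firstAbove b ps

selectGo : List ℕ → ℕ → List ℕ → List ℕ
selectGo []       prev L = []
selectGo (k ∷ ks) prev L with firstAbove (prev ⊔ k) L
... | nothing = []
... | just p  = p ∷ selectGo ks p L

selections : List ℕ → List ℕ → List ℕ
selections ks π = selectGo ks 0 (ltrMaxPositions π)

valueAt : List ℕ → ℕ → Maybe ℕ
valueAt []       p             = nothing
valueAt (x ∷ xs) zero          = nothing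
valueAt (x ∷ xs) (suc zero)    = just x
valueAt (x ∷ xs) (suc (suc p)) = valueAt xs (suc p)

isJust≡ : ℕ → Maybe ℕ → Bool
isJust≡ m nothing  = false
isJust≡ m (just v) = v ≡ᵇ m

anyᵇ : (ℕ → Bool) → List ℕ → Bool
anyᵇ f []       = false
anyᵇ f (x ∷ xs) = f x ∨ anyᵇ f xs

maxSelected : ℕ → List ℕ → List ℕ → Bool
maxSelected m ks π = anyᵇ (λ p → isJust≡ m (valueAt π p)) (selections ks π)

T : ℕ → ℕ → List ℕ → ℕ
T q m ks = length (filter (λ π → length (selections ks π) ≤? q) (perms m))

W : ℕ → List ℕ → ℕ
W m ks = length (filter (λ π → maxSelected m ks π Data.Bool.≟ true) (perms m))

-- The strategy and the position of the value m (always the last left-to-right maximum, or record)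
-- depend only on which positions are records. Summing a function of this record pattern over
-- S_(n+1) gives the sum over S_n of its value with a record appended plus n times its value with a
-- non-record appended. For "the last record is selected", appending a non-record changes nothing,
-- while a record appended at position n + 1 > k_r is selected exactly when fewer than r selections
-- were made before it; hence W(n+1) = T_(r-1)(n) + n W(n).
module Submission where

open import Defs
open import Data.Bool using (Bool; true; false; if_then_else_; _∨_)
import Data.Bool as Bool
open import Data.Fin using (Fin; toℕ; zero; suc)
open import Data.Fin.Properties using (toℕ<n)
open import Data.List
  using (List; []; _∷_; _++_; _∷ʳ_; map; concatMap; length; filter; take; lookup; last)
open import Data.List.Properties using (map-++; map-∘; map-cong; map-cong-local; length-take)
open import Data.List.Membership.Propositional.Properties using (∈-lookup)
open import Data.List.Relation.Unary.All as All using (All; []; _∷_)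
open import Data.List.Relation.Unary.All.Properties using (concat⁺; map⁺)
open import Data.List.Relation.Unary.Any using (there)
open import Data.List.Relation.Unary.Linked as Linked using (Linked)
open import Data.List.Relation.Unary.Linked.Properties using (Linked⇒All)
open import Data.Maybe using (just; nothing; _<∣>_)
open import Data.Nat
  using (ℕ; zero; suc; _+_; _*_; _∸_; _≤_; _<_; _⊔_; _<ᵇ_; _≡ᵇ_; _≟_; _≤?_; _<?_; s≤s; z<s)
open import Data.Nat.ListAction using (sum)
open import Data.Nat.ListAction.Properties using (sum-++)
open import Data.Nat.Properties
  using (≤-refl; ≤-trans; <⇒≤; <⇒≢; >⇒≢; ≤⇒≯; m≤n⇒m≤1+n; m≤m+n; ⊔-lub; +-identityʳ; +-suc; *-zeroʳ; m≤n⇒m⊓n≡m)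
open import Data.Nat.Tactic.RingSolver using (solve-∀)
open import Function using (_∘_; const)
open import Relation.Nullary.Decidable using (does; dec-true; dec-false)
open import Relation.Unary using (Decidable)
open import Relation.Binary.PropositionalEquality
  using (_≡_; _≢_; refl; sym; trans; cong; cong₂; subst; module ≡-Reasoning)

open ≡-Reasoning

<ᵇ-true : ∀ {m n} → m < n → (m <ᵇ n) ≡ true
<ᵇ-true {m} {n} = dec-true (m <? n)

<ᵇ-false : ∀ {m n} → n ≤ m → (m <ᵇ n) ≡ false
<ᵇ-false {m} {n} n≤m = dec-false (m <? n) (≤⇒≯ n≤m)

≡ᵇ-refl : ∀ m → (m ≡ᵇ m) ≡ true
≡ᵇ-refl m = dec-true (m ≟ m) refl

≡ᵇ-false : ∀ {m n} → m ≢ n → (m ≡ᵇ n) ≡ false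
≡ᵇ-false {m} {n} = dec-false (m ≟ n)

<ᵇ-suc : ∀ a i → (a <ᵇ suc i) ≡ does (a ≤? i)
<ᵇ-suc zero    i = refl
<ᵇ-suc (suc a) i = refl

does-≟-true : ∀ b → does (b Bool.≟ true) ≡ b
does-≟-true true  = refl
does-≟-true false = refl

indicator : Bool → ℕ
indicator true  = 1
indicator false = 0

length-filter≡sum : ∀ {A : Set} {P : A → Set} (P? : Decidable P) xs →
  length (filter P? xs) ≡ sum (map (indicator ∘ does ∘ P?) xs)
length-filter≡sum P? []       = refl
length-filter≡sum P? (x ∷ xs) with does (P? x)
... | true  = cong suc (length-filter≡sum P? xs)
... | false = length-filter≡sum P? xs

sum-map-concatMap : ∀ {A B : Set} (f : B → ℕ) (g : A → List B) xs →
  sum (map f (concatMap g xs)) ≡ sum (map (λ x → sum (map f (g x))) xs)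
sum-map-concatMap f g []       = refl
sum-map-concatMap f g (x ∷ xs) = begin
  sum (map f (g x ++ concatMap g xs))                ≡⟨ cong sum (map-++ f (g x) _) ⟩
  sum (map f (g x) ++ map f (concatMap g xs))        ≡⟨ sum-++ (map f (g x)) _ ⟩
  sum (map f (g x)) + sum (map f (concatMap g xs))   ≡⟨ cong (sum (map f (g x)) +_) (sum-map-concatMap f g xs) ⟩
  sum (map f (g x)) + sum (map (λ y → sum (map f (g y))) xs) ∎

sum-map-linear : ∀ {A : Set} (f g : A → ℕ) k xs →
  sum (map (λ x → f x + k * g x) xs) ≡ sum (map f xs) + k * sum (map g xs)
sum-map-linear f g k []       = sym (*-zeroʳ k)
sum-map-linear f g k (x ∷ xs) =
  trans (cong (f x + k * g x +_) (sum-map-linear f g k xs)) (interchange (f x) (g x) k _ _)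
  where
  interchange : ∀ a b k c d → (a + k * b) + (c + k * d) ≡ (a + c) + k * (b + d)
  interchange = solve-∀

last-∷ʳ : ∀ {A : Set} (xs : List A) x → last (xs ∷ʳ x) ≡ just x
last-∷ʳ []           x = refl
last-∷ʳ (y ∷ [])     x = refl
last-∷ʳ (y ∷ z ∷ zs) x = last-∷ʳ (z ∷ zs) x

anyᵇ-cong : ∀ {f g : ℕ → Bool} xs → (∀ x → f x ≡ g x) → anyᵇ f xs ≡ anyᵇ g xs
anyᵇ-cong []       f≗g = refl
anyᵇ-cong (x ∷ xs) f≗g = cong₂ _∨_ (f≗g x) (anyᵇ-cong xs f≗g)

All-insertions : ∀ {P : ℕ → Set} {x} σ → P x → All P σ → All (All P) (insertions x σ)
All-insertions []       px []         = (px ∷ []) ∷ []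
All-insertions (y ∷ ys) px (py ∷ pys) =
  (px ∷ py ∷ pys) ∷ map⁺ (All.map (py ∷_) (All-insertions ys px pys))

length-insertions : ∀ x σ → All (λ π → length π ≡ suc (length σ)) (insertions x σ)
length-insertions x []       = refl ∷ []
length-insertions x (y ∷ ys) = refl ∷ map⁺ (All.map (cong suc) (length-insertions x ys))

perms-bounded : ∀ n → All (All (_≤ n)) (perms n)
perms-bounded zero    = [] ∷ []
perms-bounded (suc n) = concat⁺ (map⁺ (All.map
  (λ {σ} σ≤n → All-insertions σ ≤-refl (All.map m≤n⇒m≤1+n σ≤n)) (perms-bounded n)))

perms-length : ∀ n → All (λ π → length π ≡ n) (perms n)
perms-length zero    = refl ∷ []
perms-length (suc n) = concat⁺ (map⁺ (All.map
  (λ {σ} |σ|≡n → All.map (λ e → trans e (cong suc |σ|≡n)) (length-insertions (suc n) σ))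
  (perms-length n)))

data StrictMax (m : ℕ) : List ℕ → Set where
  split : ∀ {xs ys} → All (_< m) xs → All (_< m) ys → StrictMax m (xs ++ m ∷ ys)

StrictMax-∷ : ∀ {m y π} → y < m → StrictMax m π → StrictMax m (y ∷ π)
StrictMax-∷ y<m (split xs<m ys<m) = split (y<m ∷ xs<m) ys<m

insertions-StrictMax : ∀ {m} σ → All (_< m) σ → All (StrictMax m) (insertions m σ)
insertions-StrictMax []       []           = split [] [] ∷ []
insertions-StrictMax (y ∷ ys) (y<m ∷ ys<m) =
  split [] (y<m ∷ ys<m) ∷ map⁺ (All.map (StrictMax-∷ y<m) (insertions-StrictMax ys ys<m))

perms-StrictMax : ∀ n → All (StrictMax (suc n)) (perms (suc n))
perms-StrictMax n = concat⁺ (map⁺ (All.map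
  (λ {σ} σ≤n → insertions-StrictMax σ (All.map s≤s σ≤n)) (perms-bounded n)))

ltrFlagsFrom : ℕ → List ℕ → List Bool
ltrFlagsFrom mx []       = []
ltrFlagsFrom mx (x ∷ xs) = (mx <ᵇ x) ∷ ltrFlagsFrom (if mx <ᵇ x then x else mx) xs

ltrFlags : List ℕ → List Bool
ltrFlags = ltrFlagsFrom 0

truePositions : ℕ → List Bool → List ℕ
truePositions p []           = []
truePositions p (true ∷ bs)  = p ∷ truePositions (suc p) bs
truePositions p (false ∷ bs) = truePositions (suc p) bs

ltrGo≡truePositions : ∀ p mx π → ltrGo p mx π ≡ truePositions p (ltrFlagsFrom mx π)
ltrGo≡truePositions p mx []       = refl
ltrGo≡truePositions p mx (x ∷ xs) with mx <ᵇ x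
... | true  = cong (p ∷_) (ltrGo≡truePositions (suc p) x xs)
... | false = ltrGo≡truePositions (suc p) mx xs

length-ltrFlagsFrom : ∀ mx π → length (ltrFlagsFrom mx π) ≡ length π
length-ltrFlagsFrom mx []       = refl
length-ltrFlagsFrom mx (x ∷ xs) = cong suc (length-ltrFlagsFrom _ xs)

runningMax-< : ∀ mx y {m} → mx < m → y < m → (if mx <ᵇ y then y else mx) < m
runningMax-< mx y mx<m y<m with mx <ᵇ y
... | true  = y<m
... | false = mx<m

ltrFlagsFrom-dominated : ∀ {m} a zs → All (_< m) zs →
  ltrFlagsFrom m zs ≡ map (const false) (ltrFlagsFrom a zs)
ltrFlagsFrom-dominated a []       []           = refl
ltrFlagsFrom-dominated a (z ∷ zs) (z<m ∷ zs<m) rewrite <ᵇ-false (<⇒≤ z<m) =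
  cong (false ∷_) (ltrFlagsFrom-dominated _ zs zs<m)

truePositions-∷ʳ-true : ∀ p bs → truePositions p (bs ∷ʳ true) ≡ truePositions p bs ∷ʳ (p + length bs)
truePositions-∷ʳ-true p []           rewrite +-identityʳ p = refl
truePositions-∷ʳ-true p (true ∷ bs)  rewrite +-suc p (length bs) = cong (p ∷_) (truePositions-∷ʳ-true (suc p) bs)
truePositions-∷ʳ-true p (false ∷ bs) rewrite +-suc p (length bs) = truePositions-∷ʳ-true (suc p) bs

truePositions-∷ʳ-false : ∀ p bs → truePositions p (bs ∷ʳ false) ≡ truePositions p bs
truePositions-∷ʳ-false p []           = refl
truePositions-∷ʳ-false p (true ∷ bs)  = cong (p ∷_) (truePositions-∷ʳ-false (suc p) bs)
truePositions-∷ʳ-false p (false ∷ bs) = truePositions-∷ʳ-false (suc p) bs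

truePositions-< : ∀ p bs → All (_< p + length bs) (truePositions p bs)
truePositions-< p []           = []
truePositions-< p (true ∷ bs)  rewrite +-suc p (length bs) = s≤s (m≤m+n p _) ∷ truePositions-< (suc p) bs
truePositions-< p (false ∷ bs) rewrite +-suc p (length bs) = truePositions-< (suc p) bs

newMaxFlags : List Bool → List (List Bool)
newMaxFlags []       = (true ∷ []) ∷ []
newMaxFlags (b ∷ bs) = (true ∷ map (const false) (b ∷ bs)) ∷ map (b ∷_) (newMaxFlags bs)

ltrFlagsFrom-insertions : ∀ {m mx} σ → mx < m → All (_< m) σ →
  map (ltrFlagsFrom mx) (insertions m σ) ≡ newMaxFlags (ltrFlagsFrom mx σ)
ltrFlagsFrom-insertions []       mx<m [] rewrite <ᵇ-true mx<m = refl
ltrFlagsFrom-insertions {m} {mx} (y ∷ ys) mx<m (y<m ∷ ys<m) rewrite <ᵇ-true mx<m =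
  cong₂ _∷_ (cong (true ∷_) (ltrFlagsFrom-dominated mx (y ∷ ys) (y<m ∷ ys<m))) (begin
    map (ltrFlagsFrom mx) (map (y ∷_) (insertions m ys))
      ≡⟨ trans (sym (map-∘ (insertions m ys))) (map-∘ (insertions m ys)) ⟩
    map ((mx <ᵇ y) ∷_) (map (ltrFlagsFrom mx′) (insertions m ys))
      ≡⟨ cong (map ((mx <ᵇ y) ∷_)) (ltrFlagsFrom-insertions ys (runningMax-< mx y mx<m y<m) ys<m) ⟩
    map ((mx <ᵇ y) ∷_) (newMaxFlags (ltrFlagsFrom mx′ ys)) ∎)
  where
  mx′ : ℕ
  mx′ = if mx <ᵇ y then y else mx

newMaxFlags-∷ʳ : ∀ bs x →
  newMaxFlags (bs ∷ʳ x) ≡ map (_∷ʳ false) (newMaxFlags bs) ∷ʳ (bs ∷ʳ x ∷ʳ true)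
newMaxFlags-∷ʳ []       x = refl
newMaxFlags-∷ʳ (b ∷ bs) x =
  cong₂ _∷_ (cong (λ fs → true ∷ false ∷ fs) (map-++ (const false) bs (x ∷ []))) (begin
    map (b ∷_) (newMaxFlags (bs ∷ʳ x))
      ≡⟨ cong (map (b ∷_)) (newMaxFlags-∷ʳ bs x) ⟩
    map (b ∷_) (map (_∷ʳ false) (newMaxFlags bs) ∷ʳ (bs ∷ʳ x ∷ʳ true))
      ≡⟨ map-++ (b ∷_) (map (_∷ʳ false) (newMaxFlags bs)) _ ⟩
    map (b ∷_) (map (_∷ʳ false) (newMaxFlags bs)) ∷ʳ (b ∷ bs ∷ʳ x ∷ʳ true)
      ≡⟨ cong (_∷ʳ (b ∷ bs ∷ʳ x ∷ʳ true)) (trans (sym (map-∘ (newMaxFlags bs))) (map-∘ (newMaxFlags bs))) ⟩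
    map (_∷ʳ false) (map (b ∷_) (newMaxFlags bs)) ∷ʳ (b ∷ bs ∷ʳ x ∷ʳ true) ∎)

sumFlags : ℕ → (List Bool → ℕ) → ℕ
sumFlags n h = sum (map (h ∘ ltrFlags) (perms n))

sumFlags-cong : ∀ n {f g : List Bool → ℕ} → (∀ bs → length bs ≡ n → f bs ≡ g bs) →
  sumFlags n f ≡ sumFlags n g
sumFlags-cong n f≗g = cong sum (map-cong-local (All.map
  (λ {π} |π|≡n → f≗g (ltrFlags π) (trans (length-ltrFlagsFrom 0 π) |π|≡n)) (perms-length n)))

sumFlags-linear : ∀ n (f g : List Bool → ℕ) k →
  sumFlags n (λ bs → f bs + k * g bs) ≡ sumFlags n f + k * sumFlags n g
sumFlags-linear n f g k = sum-map-linear (f ∘ ltrFlags) (g ∘ ltrFlags) k (perms n)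

extendMax : (List Bool → ℕ) → List Bool → ℕ
extendMax h bs = sum (map h (newMaxFlags bs))

extendLast : ℕ → (List Bool → ℕ) → List Bool → ℕ
extendLast n h bs = h (bs ∷ʳ true) + n * h (bs ∷ʳ false)

sumFlags-suc : ∀ n h → sumFlags (suc n) h ≡ sumFlags n (extendMax h)
sumFlags-suc n h = trans (sum-map-concatMap (h ∘ ltrFlags) (insertions (suc n)) (perms n))
  (cong sum (map-cong-local (All.map (λ {σ} σ≤n → cong sum (trans (map-∘ (insertions (suc n) σ))
    (cong (map h) (ltrFlagsFrom-insertions σ z<s (All.map s≤s σ≤n))))) (perms-bounded n))))

extendMax-∷ʳ : ∀ h bs x →
  extendMax h (bs ∷ʳ x) ≡ extendMax (h ∘ (_∷ʳ false)) bs + h (bs ∷ʳ x ∷ʳ true)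
extendMax-∷ʳ h bs x = begin
  sum (map h (newMaxFlags (bs ∷ʳ x)))
    ≡⟨ cong (sum ∘ map h) (newMaxFlags-∷ʳ bs x) ⟩
  sum (map h (map (_∷ʳ false) (newMaxFlags bs) ∷ʳ last′))
    ≡⟨ cong sum (map-++ h (map (_∷ʳ false) (newMaxFlags bs)) (last′ ∷ [])) ⟩
  sum (map h (map (_∷ʳ false) (newMaxFlags bs)) ∷ʳ h last′)
    ≡⟨ sum-++ (map h (map (_∷ʳ false) (newMaxFlags bs))) (h last′ ∷ []) ⟩
  sum (map h (map (_∷ʳ false) (newMaxFlags bs))) + (h last′ + 0)
    ≡⟨ cong₂ _+_ (cong sum (sym (map-∘ (newMaxFlags bs)))) (+-identityʳ (h last′)) ⟩
  sum (map (h ∘ (_∷ʳ false)) (newMaxFlags bs)) + h last′ ∎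
  where
  last′ : List Bool
  last′ = bs ∷ʳ x ∷ʳ true

extendLast-extendMax : ∀ n h bs → extendLast n (extendMax h) bs
  ≡ extendLast n (h ∘ (_∷ʳ true)) bs + suc n * extendMax (h ∘ (_∷ʳ false)) bs
extendLast-extendMax n h bs =
  trans (cong₂ (λ a b → a + n * b) (extendMax-∷ʳ h bs true) (extendMax-∷ʳ h bs false))
        (regroup (extendMax (h ∘ (_∷ʳ false)) bs) _ n _)
  where
  regroup : ∀ e a n b → (e + a) + n * (e + b) ≡ (a + n * b) + suc n * e
  regroup = solve-∀

extendLast-extendLast : ∀ n h bs → extendLast n (extendLast (suc n) h) bs
  ≡ extendLast n (h ∘ (_∷ʳ true)) bs + suc n * extendLast n (h ∘ (_∷ʳ false)) bs
extendLast-extendLast n h bs = regroup (h (bs ∷ʳ true ∷ʳ true)) _ n _ _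
  where
  regroup : ∀ a b n c d → (a + suc n * b) + n * (c + suc n * d) ≡ (a + n * c) + suc n * (b + n * d)
  regroup = solve-∀

sumFlags-last : ∀ n h → sumFlags (suc n) h ≡ sumFlags n (extendLast n h)

-- perms inserts the new maximum at every place; this turns that decomposition into the
-- decomposition by the last entry, a record for exactly one of its n + 1 values.
sumFlags-extendMax : ∀ n h → sumFlags n (extendMax h) ≡ sumFlags n (extendLast n h)
sumFlags-extendMax zero    h = refl
sumFlags-extendMax (suc n) h = begin
  sumFlags (suc n) (extendMax h)
    ≡⟨ sumFlags-last n (extendMax h) ⟩
  sumFlags n (extendLast n (extendMax h))
    ≡⟨ sumFlags-cong n (λ bs _ → extendLast-extendMax n h bs) ⟩
  sumFlags n (λ bs → extendLast n (h ∘ (_∷ʳ true)) bs + suc n * extendMax (h ∘ (_∷ʳ false)) bs)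
    ≡⟨ sumFlags-linear n (extendLast n (h ∘ (_∷ʳ true))) (extendMax (h ∘ (_∷ʳ false))) (suc n) ⟩
  sumFlags n (extendLast n (h ∘ (_∷ʳ true))) + suc n * sumFlags n (extendMax (h ∘ (_∷ʳ false)))
    ≡⟨ cong (λ s → sumFlags n (extendLast n (h ∘ (_∷ʳ true))) + suc n * s)
            (sumFlags-extendMax n (h ∘ (_∷ʳ false))) ⟩
  sumFlags n (extendLast n (h ∘ (_∷ʳ true))) + suc n * sumFlags n (extendLast n (h ∘ (_∷ʳ false)))
    ≡⟨ sym (sumFlags-linear n (extendLast n (h ∘ (_∷ʳ true))) (extendLast n (h ∘ (_∷ʳ false))) (suc n)) ⟩
  sumFlags n (λ bs → extendLast n (h ∘ (_∷ʳ true)) bs + suc n * extendLast n (h ∘ (_∷ʳ false)) bs)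
    ≡⟨ sumFlags-cong n (λ bs _ → sym (extendLast-extendLast n h bs)) ⟩
  sumFlags n (extendLast n (extendLast (suc n) h))
    ≡⟨ sym (sumFlags-last n (extendLast (suc n) h)) ⟩
  sumFlags (suc n) (extendLast (suc n) h) ∎

sumFlags-last n h = trans (sumFlags-suc n h) (sumFlags-extendMax n h)

firstAbove-∷ʳ : ∀ {b N} L → b < N → firstAbove b (L ∷ʳ N) ≡ firstAbove b L <∣> just N
firstAbove-∷ʳ     []      b<N rewrite <ᵇ-true b<N = refl
firstAbove-∷ʳ {b} (x ∷ L) b<N with b <ᵇ x
... | true  = refl
... | false = firstAbove-∷ʳ L b<N

firstAbove-All : ∀ {P : ℕ → Set} {b p} L → All P L → firstAbove b L ≡ just p → P p
firstAbove-All {b = b} (x ∷ L) (px ∷ pL) found with b <ᵇ x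
firstAbove-All (x ∷ L) (px ∷ pL) refl  | true  = px
firstAbove-All (x ∷ L) (px ∷ pL) found | false = firstAbove-All L pL found

selectGo-∷ʳ : ∀ {N} ks prev L → All (_< N) ks → prev < N → All (_< N) L →
  anyᵇ (N ≡ᵇ_) (selectGo ks prev (L ∷ʳ N)) ≡ (length (selectGo ks prev L) <ᵇ length ks)
selectGo-∷ʳ []       prev L _ _ _ = refl
selectGo-∷ʳ {N} (k ∷ ks) prev L (k<N ∷ ks<N) prev<N L<N
  rewrite firstAbove-∷ʳ L (⊔-lub prev<N k<N) with firstAbove (prev ⊔ k) L in found
... | just p  rewrite ≡ᵇ-false (>⇒≢ (firstAbove-All L L<N found)) =
  selectGo-∷ʳ ks p L ks<N (firstAbove-All L L<N found) L<N
... | nothing rewrite ≡ᵇ-refl N = refl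

lastSelected : List ℕ → List ℕ → Bool
lastSelected ks L = anyᵇ (λ p → isJust≡ p (last L)) (selectGo ks 0 L)

lastSelected-∷ʳ : ∀ {N} ks L → All (_< N) ks → 0 < N → All (_< N) L →
  lastSelected ks (L ∷ʳ N) ≡ (length (selectGo ks 0 L) <ᵇ length ks)
lastSelected-∷ʳ {N} ks L ks<N 0<N L<N rewrite last-∷ʳ L N = selectGo-∷ʳ ks 0 L ks<N 0<N L<N

ltrGo-dominated : ∀ {m} p zs → All (_< m) zs → ltrGo p m zs ≡ []
ltrGo-dominated p []       []           = refl
ltrGo-dominated p (z ∷ zs) (z<m ∷ zs<m) rewrite <ᵇ-false (<⇒≤ z<m) = ltrGo-dominated (suc p) zs zs<m

ltrGo-StrictMax : ∀ {m mx} p xs ys → mx < m → All (_< m) xs → All (_< m) ys →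
  ltrGo p mx (xs ++ m ∷ ys) ≡ ltrGo p mx xs ∷ʳ (p + length xs)
ltrGo-StrictMax p [] ys mx<m [] ys<m
  rewrite <ᵇ-true mx<m | ltrGo-dominated (suc p) ys ys<m | +-identityʳ p = refl
ltrGo-StrictMax {mx = mx} p (x ∷ xs) ys mx<m (x<m ∷ xs<m) ys<m rewrite +-suc p (length xs) with mx <ᵇ x
... | true  = cong (p ∷_) (ltrGo-StrictMax (suc p) xs ys x<m xs<m ys<m)
... | false = ltrGo-StrictMax (suc p) xs ys mx<m xs<m ys<m

valueAt-dominated : ∀ {m} ys → All (_< m) ys → ∀ p → isJust≡ m (valueAt ys p) ≡ false
valueAt-dominated []       _            p             = refl
valueAt-dominated (y ∷ ys) _            zero          = refl
valueAt-dominated (y ∷ ys) (y<m ∷ _)    (suc zero)    = ≡ᵇ-false (<⇒≢ y<m)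
valueAt-dominated (y ∷ ys) (_ ∷ ys<m)   (suc (suc p)) = valueAt-dominated ys ys<m (suc p)

valueAt-StrictMax : ∀ {m} xs ys → All (_< m) xs → All (_< m) ys →
  ∀ p → isJust≡ m (valueAt (xs ++ m ∷ ys) p) ≡ (suc (length xs) ≡ᵇ p)
valueAt-StrictMax     []       ys _            ys<m zero          = refl
valueAt-StrictMax {m} []       ys _            ys<m (suc zero)    = ≡ᵇ-refl m
valueAt-StrictMax     []       ys _            ys<m (suc (suc p)) = valueAt-dominated ys ys<m (suc p)
valueAt-StrictMax     (x ∷ xs) ys _            ys<m zero          = refl
valueAt-StrictMax     (x ∷ xs) ys (x<m ∷ _)    ys<m (suc zero)    = ≡ᵇ-false (<⇒≢ x<m)
valueAt-StrictMax     (x ∷ xs) ys (_ ∷ xs<m)   ys<m (suc (suc p)) = valueAt-StrictMax xs ys xs<m ys<m (suc p)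

-- In a permutation the maximum sits at the last record.
maxSelected≡lastSelected : ∀ {n} ks {π} → StrictMax (suc n) π →
  maxSelected (suc n) ks π ≡ lastSelected ks (ltrMaxPositions π)
maxSelected≡lastSelected {n} ks (split {xs} {ys} xs<m ys<m) =
  anyᵇ-cong (selections ks (xs ++ suc n ∷ ys)) λ p → begin
    isJust≡ (suc n) (valueAt (xs ++ suc n ∷ ys) p)  ≡⟨ valueAt-StrictMax xs ys xs<m ys<m p ⟩
    (suc (length xs) ≡ᵇ p)                           ≡⟨ cong (isJust≡ p) (sym lastPosition) ⟩
    isJust≡ p (last (ltrMaxPositions (xs ++ suc n ∷ ys))) ∎
  where
  lastPosition : last (ltrMaxPositions (xs ++ suc n ∷ ys)) ≡ just (suc (length xs))
  lastPosition = trans (cong last (ltrGo-StrictMax 1 xs ys z<s xs<m ys<m)) (last-∷ʳ (ltrGo 1 0 xs) _)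

lastRecordSelected : List ℕ → List Bool → ℕ
lastRecordSelected ks bs = indicator (lastSelected ks (truePositions 1 bs))

atMostSelections : ℕ → List ℕ → List Bool → ℕ
atMostSelections q ks bs = indicator (does (length (selectGo ks 0 (truePositions 1 bs)) ≤? q))

lastRecordSelected-∷ʳ-false : ∀ ks bs → lastRecordSelected ks (bs ∷ʳ false) ≡ lastRecordSelected ks bs
lastRecordSelected-∷ʳ-false ks bs = cong (indicator ∘ lastSelected ks) (truePositions-∷ʳ-false 1 bs)

lastRecordSelected-∷ʳ-true : ∀ i ks bs → length ks ≡ suc i → All (_≤ length bs) ks →
  lastRecordSelected ks (bs ∷ʳ true) ≡ atMostSelections i ks bs
lastRecordSelected-∷ʳ-true i ks bs |ks|≡1+i ks≤|bs| = begin
  indicator (lastSelected ks (truePositions 1 (bs ∷ʳ true)))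
    ≡⟨ cong (indicator ∘ lastSelected ks) (truePositions-∷ʳ-true 1 bs) ⟩
  indicator (lastSelected ks (L ∷ʳ suc (length bs)))
    ≡⟨ cong indicator (lastSelected-∷ʳ ks L (All.map s≤s ks≤|bs|) z<s (truePositions-< 1 bs)) ⟩
  indicator (length (selectGo ks 0 L) <ᵇ length ks)
    ≡⟨ cong (λ r → indicator (length (selectGo ks 0 L) <ᵇ r)) |ks|≡1+i ⟩
  indicator (length (selectGo ks 0 L) <ᵇ suc i)
    ≡⟨ cong indicator (<ᵇ-suc (length (selectGo ks 0 L)) i) ⟩
  atMostSelections i ks bs ∎
  where
  L : List ℕ
  L = truePositions 1 bs

W≡sumFlags : ∀ n ks → W n ks ≡ sumFlags n (lastRecordSelected ks)
W≡sumFlags zero    []       = refl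
W≡sumFlags zero    (k ∷ ks) = refl
W≡sumFlags (suc n) ks =
  trans (length-filter≡sum (λ π → maxSelected (suc n) ks π Bool.≟ true) (perms (suc n)))
        (cong sum (map-cong-local (All.map pointwise (perms-StrictMax n))))
  where
  pointwise : ∀ {π} → StrictMax (suc n) π →
    indicator (does (maxSelected (suc n) ks π Bool.≟ true)) ≡ lastRecordSelected ks (ltrFlags π)
  pointwise {π} π-max = cong indicator (begin
    does (maxSelected (suc n) ks π Bool.≟ true)   ≡⟨ does-≟-true _ ⟩
    maxSelected (suc n) ks π                      ≡⟨ maxSelected≡lastSelected ks π-max ⟩
    lastSelected ks (ltrMaxPositions π)           ≡⟨ cong (lastSelected ks) (ltrGo≡truePositions 1 0 π) ⟩
    lastSelected ks (truePositions 1 (ltrFlags π)) ∎)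

T≡sumFlags : ∀ q n ks → T q n ks ≡ sumFlags n (atMostSelections q ks)
T≡sumFlags q n ks =
  trans (length-filter≡sum (λ π → length (selections ks π) ≤? q) (perms n))
        (cong sum (map-cong (λ π → cong (λ L → indicator (does (length (selectGo ks 0 L) ≤? q)))
                                        (ltrGo≡truePositions 1 0 π)) (perms n)))

W-recursion : ∀ i n ks → length ks ≡ suc i → All (_≤ n) ks →
  W (suc n) ks ≡ T i n ks + n * W n ks
W-recursion i n ks |ks|≡1+i ks≤n = begin
  W (suc n) ks                                ≡⟨ W≡sumFlags (suc n) ks ⟩
  sumFlags (suc n) w                          ≡⟨ sumFlags-last n w ⟩
  sumFlags n (extendLast n w)                 ≡⟨ sumFlags-cong n lastEntry ⟩
  sumFlags n (λ bs → t bs + n * w bs)         ≡⟨ sumFlags-linear n t w n ⟩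
  sumFlags n t + n * sumFlags n w
    ≡⟨ cong₂ (λ a b → a + n * b) (sym (T≡sumFlags i n ks)) (sym (W≡sumFlags n ks)) ⟩
  T i n ks + n * W n ks ∎
  where
  w t : List Bool → ℕ
  w = lastRecordSelected ks
  t = atMostSelections i ks
  lastEntry : ∀ bs → length bs ≡ n → extendLast n w bs ≡ t bs + n * w bs
  lastEntry bs |bs|≡n = cong₂ (λ a b → a + n * b)
    (lastRecordSelected-∷ʳ-true i ks bs |ks|≡1+i (subst (λ l → All (_≤ l) ks) (sym |bs|≡n) ks≤n))
    (lastRecordSelected-∷ʳ-false ks bs)

length-take-suc-toℕ : ∀ {A : Set} (xs : List A) (i : Fin (length xs)) →
  length (take (suc (toℕ i)) xs) ≡ suc (toℕ i)
length-take-suc-toℕ xs i = trans (length-take (suc (toℕ i)) xs) (m≤n⇒m⊓n≡m (toℕ<n i))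

take-≤-lookup : ∀ {ks} → Linked _≤_ ks → (i : Fin (length ks)) →
  All (_≤ lookup ks i) (take (suc (toℕ i)) ks)
take-≤-lookup {x ∷ xs} sorted zero    = ≤-refl ∷ []
take-≤-lookup {x ∷ xs} sorted (suc j) =
  All.lookup (Linked⇒All ≤-trans ≤-refl sorted) (there (∈-lookup j)) ∷ take-≤-lookup (Linked.tail sorted) j

mainTheorem11 : (N : ℕ) (ks : List ℕ) → Linked _≤_ ks → All (_≤ N) ks →
    (i : Fin (length ks)) (m : ℕ) → suc (lookup ks i) ≤ m →
      W m (take (suc (toℕ i)) ks)
        ≡ T (toℕ i) (m ∸ 1) (take (suc (toℕ i)) ks)
          + (m ∸ 1) * W (m ∸ 1) (take (suc (toℕ i)) ks)
mainTheorem11 _ ks sorted _ i (suc n) (s≤s kᵣ≤n) =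
  W-recursion (toℕ i) n (take (suc (toℕ i)) ks) (length-take-suc-toℕ ks i)
    (All.map (λ k≤kᵣ → ≤-trans k≤kᵣ kᵣ≤n) (take-≤-lookup sorted i))
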